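{- Let $G$ be a connected graph such that at least one of the following holds: (1) every graph search ordering of $G$ is a BFS ordering; (2) every graph search ordering of $G$ is a DFS ordering; (3) an ordering of $V(G)$ is a BFS ordering if and only if it is a DFS ordering. Then $G$ is $\{P_4, C_4, \text{paw}, \text{diamond}\}$-free.
   Context: All graphs are finite and simple. For an ordering $\sigma$ of $V(G)$ write $x<_\sigma y$ if $x$ precedes $y$. A graph search ordering of $G$ is an ordering of $V(G)$ such that every prefix induces a connected subgraph. $\sigma$ is a BFS ordering if whenever $a<_\sigma b<_\sigma c$, $ac\in E(G)$, $ab\notin E(G)$, there is $d$ with $d<_\sigma a$ and $db\in E(G)$; it is a DFS ordering if under the same conditions there is $d$ with $a<_\sigma d<_\sigma b$ and $db\in E(G)$. The paw is a triangle plus one extra vertex adjacent to exactly one triangle vertex; the diamond is $K_4$ minus one edge. $\mathcal{F}$-free means no induced subgraph isomorphic to a member of $\mathcal{F}$. -}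

module Defs where

open import Data.Nat using (ℕ; zero; suc; _<_)
open import Data.Fin using (Fin; zero; suc; toℕ)
open import Data.Fin.Permutation using (Permutation′; _⟨$⟩ʳ_; _⟨$⟩ˡ_)
open import Data.Bool using (Bool; true; false)
open import Data.Product using (Σ; ∃; _×_; _,_)
open import Data.Sum using (_⊎_)
open import Relation.Binary.PropositionalEquality using (_≡_; refl)
open import Relation.Nullary using (¬_)
open import Function.Definitions using (Injective)

record Graph : Set where
  field
    n     : ℕ
    adj   : Fin n → Fin n → Bool
    sym   : ∀ x y → adj x y ≡ adj y x
    irr   : ∀ x → adj x x ≡ false
open Graph public

Adj : (G : Graph) → Fin (n G) → Fin (n G) → Set
Adj G x y = adj G x y ≡ true

data WalkIn (G : Graph) (S : Fin (n G) → Set) : Fin (n G) → Fin (n G) → Set where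
  here : ∀ {x} → S x → WalkIn G S x x
  step : ∀ {x y z} → S x → Adj G x y → WalkIn G S y z → WalkIn G S x z

InducedConnected : (G : Graph) → (Fin (n G) → Set) → Set
InducedConnected G S = ∀ x y → S x → S y → WalkIn G S x y

Connected : Graph → Set
Connected G = InducedConnected G (λ _ → Data.Unit.⊤)
  where import Data.Unit

-- An ordering of V(G): a permutation; σ ⟨$⟩ʳ i is the vertex in position i,
-- σ ⟨$⟩ˡ v is the position of vertex v.
Ordering : Graph → Set
Ordering G = Permutation′ (n G)

Before : (G : Graph) → Ordering G → Fin (n G) → Fin (n G) → Set
Before G σ x y = toℕ (σ ⟨$⟩ˡ x) < toℕ (σ ⟨$⟩ˡ y)

IsGraphSearch : (G : Graph) → Ordering G → Set
IsGraphSearch G σ = (k : ℕ) → InducedConnected G (λ v → toℕ (σ ⟨$⟩ˡ v) < k)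

IsBFS : (G : Graph) → Ordering G → Set
IsBFS G σ = ∀ a b c → Before G σ a b → Before G σ b c → Adj G a c → ¬ Adj G a b →
  ∃ λ d → Before G σ d a × Adj G d b

IsDFS : (G : Graph) → Ordering G → Set
IsDFS G σ = ∀ a b c → Before G σ a b → Before G σ b c → Adj G a c → ¬ Adj G a b →
  ∃ λ d → Before G σ a d × Before G σ d b × Adj G d b

InducedSub : Graph → Graph → Set
InducedSub H G = Σ (Fin (n H) → Fin (n G)) λ f →
  Injective _≡_ _≡_ f × (∀ i j → adj H i j ≡ adj G (f i) (f j))

private
  mk4 : (ℕ → ℕ → Bool) → Fin 4 → Fin 4 → Bool
  mk4 e i j = e (toℕ i) (toℕ j)

p4e : ℕ → ℕ → Bool
p4e 0 1 = true
p4e 1 0 = true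
p4e 1 2 = true
p4e 2 1 = true
p4e 2 3 = true
p4e 3 2 = true
p4e _ _ = false

c4e : ℕ → ℕ → Bool
c4e 0 1 = true
c4e 1 0 = true
c4e 1 2 = true
c4e 2 1 = true
c4e 2 3 = true
c4e 3 2 = true
c4e 3 0 = true
c4e 0 3 = true
c4e _ _ = false

pawe : ℕ → ℕ → Bool
pawe 0 1 = true
pawe 1 0 = true
pawe 1 2 = true
pawe 2 1 = true
pawe 0 2 = true
pawe 2 0 = true
pawe 0 3 = true
pawe 3 0 = true
pawe _ _ = false

diae : ℕ → ℕ → Bool
diae 0 1 = true
diae 1 0 = true
diae 0 2 = true
diae 2 0 = true
diae 0 3 = true
diae 3 0 = true
diae 1 2 = true
diae 2 1 = true
diae 1 3 = true
diae 3 1 = true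
diae _ _ = false

f0 f1 f2 f3 : Fin 4
f0 = zero
f1 = suc zero
f2 = suc (suc zero)
f3 = suc (suc (suc zero))

P4 : Graph
P4 = record { n = 4 ; adj = mk4 p4e ; sym = s ; irr = r }
  where
  s : ∀ x y → mk4 p4e x y ≡ mk4 p4e y x
  s zero zero = refl
  s zero (suc zero) = refl
  s zero (suc (suc zero)) = refl
  s zero (suc (suc (suc zero))) = refl
  s (suc zero) zero = refl
  s (suc zero) (suc zero) = refl
  s (suc zero) (suc (suc zero)) = refl
  s (suc zero) (suc (suc (suc zero))) = refl
  s (suc (suc zero)) zero = refl
  s (suc (suc zero)) (suc zero) = refl
  s (suc (suc zero)) (suc (suc zero)) = refl
  s (suc (suc zero)) (suc (suc (suc zero))) = refl
  s (suc (suc (suc zero))) zero = refl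
  s (suc (suc (suc zero))) (suc zero) = refl
  s (suc (suc (suc zero))) (suc (suc zero)) = refl
  s (suc (suc (suc zero))) (suc (suc (suc zero))) = refl
  r : ∀ x → mk4 p4e x x ≡ false
  r zero = refl
  r (suc zero) = refl
  r (suc (suc zero)) = refl
  r (suc (suc (suc zero))) = refl

C4 : Graph
C4 = record { n = 4 ; adj = mk4 c4e ; sym = s ; irr = r }
  where
  s : ∀ x y → mk4 c4e x y ≡ mk4 c4e y x
  s zero zero = refl
  s zero (suc zero) = refl
  s zero (suc (suc zero)) = refl
  s zero (suc (suc (suc zero))) = refl
  s (suc zero) zero = refl
  s (suc zero) (suc zero) = refl
  s (suc zero) (suc (suc zero)) = refl
  s (suc zero) (suc (suc (suc zero))) = refl
  s (suc (suc zero)) zero = refl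
  s (suc (suc zero)) (suc zero) = refl
  s (suc (suc zero)) (suc (suc zero)) = refl
  s (suc (suc zero)) (suc (suc (suc zero))) = refl
  s (suc (suc (suc zero))) zero = refl
  s (suc (suc (suc zero))) (suc zero) = refl
  s (suc (suc (suc zero))) (suc (suc zero)) = refl
  s (suc (suc (suc zero))) (suc (suc (suc zero))) = refl
  r : ∀ x → mk4 c4e x x ≡ false
  r zero = refl
  r (suc zero) = refl
  r (suc (suc zero)) = refl
  r (suc (suc (suc zero))) = refl

Paw : Graph
Paw = record { n = 4 ; adj = mk4 pawe ; sym = s ; irr = r }
  where
  s : ∀ x y → mk4 pawe x y ≡ mk4 pawe y x
  s zero zero = refl
  s zero (suc zero) = refl
  s zero (suc (suc zero)) = refl
  s zero (suc (suc (suc zero))) = refl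
  s (suc zero) zero = refl
  s (suc zero) (suc zero) = refl
  s (suc zero) (suc (suc zero)) = refl
  s (suc zero) (suc (suc (suc zero))) = refl
  s (suc (suc zero)) zero = refl
  s (suc (suc zero)) (suc zero) = refl
  s (suc (suc zero)) (suc (suc zero)) = refl
  s (suc (suc zero)) (suc (suc (suc zero))) = refl
  s (suc (suc (suc zero))) zero = refl
  s (suc (suc (suc zero))) (suc zero) = refl
  s (suc (suc (suc zero))) (suc (suc zero)) = refl
  s (suc (suc (suc zero))) (suc (suc (suc zero))) = refl
  r : ∀ x → mk4 pawe x x ≡ false
  r zero = refl
  r (suc zero) = refl
  r (suc (suc zero)) = refl
  r (suc (suc (suc zero))) = refl

Diamond : Graph
Diamond = record { n = 4 ; adj = mk4 diae ; sym = s ; irr = r }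
  where
  s : ∀ x y → mk4 diae x y ≡ mk4 diae y x
  s zero zero = refl
  s zero (suc zero) = refl
  s zero (suc (suc zero)) = refl
  s zero (suc (suc (suc zero))) = refl
  s (suc zero) zero = refl
  s (suc zero) (suc zero) = refl
  s (suc zero) (suc (suc zero)) = refl
  s (suc zero) (suc (suc (suc zero))) = refl
  s (suc (suc zero)) zero = refl
  s (suc (suc zero)) (suc zero) = refl
  s (suc (suc zero)) (suc (suc zero)) = refl
  s (suc (suc zero)) (suc (suc (suc zero))) = refl
  s (suc (suc (suc zero))) zero = refl
  s (suc (suc (suc zero))) (suc zero) = refl
  s (suc (suc (suc zero))) (suc (suc zero)) = refl
  s (suc (suc (suc zero))) (suc (suc (suc zero))) = refl
  r : ∀ x → mk4 diae x x ≡ false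
  r zero = refl
  r (suc zero) = refl
  r (suc (suc zero)) = refl
  r (suc (suc (suc zero))) = refl

P4C4PawDiamondFree : Graph → Set
P4C4PawDiamondFree G =
  ¬ InducedSub P4 G × ¬ InducedSub C4 G × ¬ InducedSub Paw G × ¬ InducedSub Diamond G

-- Each of P₄, C₄, the paw and the diamond contains a tailed cherry: an induced path
-- u r v together with a neighbour w ∉ {r, v} of u. Start a search with u, r, v and continue
-- breadth-first: it is a graph search, w comes after v, and the BFS rule for u < v < w asks
-- for a vertex before u. Start instead with r, u, v: the result is a BFS ordering, while the
-- DFS rule for u < v < w asks for a vertex strictly between positions 1 and 2. Such searches
-- exist by greedy extension, always visiting an unseen neighbour of the earliest vertex that
-- has one.
module Submission where

open import Defs
open import Data.Product using (_×_)
open import Data.Sum using (_⊎_)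
open import Function.Bundles using (_⇔_)

open import Data.Bool using (true)
import Data.Bool.Properties as Bool
open import Data.Empty using (⊥; ⊥-elim)
open import Data.Fin using (Fin; zero; suc; toℕ; fromℕ<; punchOut)
open import Data.Fin.Properties
  using (toℕ-fromℕ<; toℕ-injective; toℕ<n; any?; injective⇒≤; punchOut-injective)
  renaming (_≟_ to _≟ᶠ_)
open import Data.Fin.Permutation using (Permutation′; permutation; _⟨$⟩ʳ_; _⟨$⟩ˡ_; inverseʳ)
open import Data.Nat using (ℕ; zero; suc; _<_; _≤_; _+_; z≤n; s≤s; _<?_; _≤?_)
open import Data.Nat.Properties
  using (≤-refl; ≤-trans; ≤-pred; <-trans; <-≤-trans; ≤-<-trans; <-irrefl; ≮⇒≥; ≤∧≢⇒<;
         m<n⇒m<1+n; m<1+n⇒m≤n; ≰⇒>; ≤-antisym; n≮0; +-suc; <⇒≤; m≤m+n)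
open import Data.Product using (Σ; ∃; _,_; proj₁; proj₂)
open import Data.Sum using (inj₁; inj₂; [_,_]′)
open import Data.Unit using (tt)
open import Function.Bundles using (Equivalence)
open import Function.Definitions using (Injective)
open import Relation.Binary.PropositionalEquality as ≡ using (_≡_; _≢_; refl; trans; cong; subst; subst₂)
open import Relation.Nullary using (¬_; Dec; yes; no)
open import Relation.Nullary.Decidable using (_×-dec_)
open import Relation.Unary using (Decidable)

injective⇒surjective : ∀ {m} {f : Fin m → Fin m} → Injective _≡_ _≡_ f → ∀ j → ∃ λ i → f i ≡ j
injective⇒surjective {suc m} {f} f-injective j with any? (λ i → f i ≟ᶠ j)
... | yes hit = hit
... | no miss = ⊥-elim (<-irrefl refl (injective⇒≤ g-injective))
  where
  j≢f : ∀ i → j ≢ f i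
  j≢f i eq = miss (i , ≡.sym eq)
  g : Fin (suc m) → Fin m
  g i = punchOut (j≢f i)
  g-injective : Injective _≡_ _≡_ g
  g-injective {a} {b} eq = f-injective (punchOut-injective (j≢f a) (j≢f b) eq)

minimiser : ∀ {m} {Q : Fin m → Set} → Decidable Q → (f : Fin m → ℕ) →
            ∃ Q → ∃ λ x → Q x × (∀ y → Q y → f x ≤ f y)
minimiser {Q = Q} Q? f (x , qx) = descend (f x) x qx ≤-refl
  where
  descend : ∀ bound x → Q x → f x ≤ bound → ∃ λ x → Q x × (∀ y → Q y → f x ≤ f y)
  descend bound x qx fx≤bound with any? (λ y → Q? y ×-dec (f y <? f x))
  ... | no none = x , qx , λ y qy → ≮⇒≥ (λ fy<fx → none (y , qy , fy<fx))
  descend zero x qx fx≤0 | yes (y , _ , fy<fx) = ⊥-elim (n≮0 (<-≤-trans fy<fx fx≤0))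
  descend (suc bound) x qx fx≤bound | yes (y , qy , fy<fx) =
    descend bound y qy (≤-pred (≤-trans fy<fx fx≤bound))

rankPermutation : ∀ {N} (rank : Fin N → ℕ) → (∀ x → rank x < N) →
                  (∀ x y → rank x ≡ rank y → x ≡ y) →
                  Σ (Permutation′ N) λ σ → ∀ x → toℕ (σ ⟨$⟩ˡ x) ≡ rank x
rankPermutation rank rank<N rank-injective = σ , λ x → toℕ-fromℕ< (rank<N x)
  where
  position : Fin _ → Fin _
  position x = fromℕ< (rank<N x)
  position-injective : Injective _≡_ _≡_ position
  position-injective {x} {y} eq = rank-injective x y (begin
    rank x ≡⟨ ≡.sym (toℕ-fromℕ< (rank<N x)) ⟩
    toℕ (position x) ≡⟨ cong toℕ eq ⟩
    toℕ (position y) ≡⟨ toℕ-fromℕ< (rank<N y) ⟩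
    rank y ∎)
    where open ≡.≡-Reasoning
  vertexAt : Fin _ → Fin _
  vertexAt i = proj₁ (injective⇒surjective position-injective i)
  σ : Permutation′ _
  σ = permutation vertexAt position
        (λ x → position-injective (proj₂ (injective⇒surjective position-injective (position x))))
        (λ i → proj₂ (injective⇒surjective position-injective i))

module Properties (G : Graph) where

  Adj-sym : ∀ {x y} → Adj G x y → Adj G y x
  Adj-sym {x} {y} xy = trans (Graph.sym G y x) xy

  Adj⇒≢ : ∀ {x y} → Adj G x y → x ≢ y
  Adj⇒≢ {x} xy refl with trans (≡.sym (irr G x)) xy
  ... | ()

  Adj? : ∀ x y → Dec (Adj G x y)
  Adj? x y = adj G x y Bool.≟ true

  module _ {S : Fin (n G) → Set} where

    _▷_ : ∀ {x y z} → WalkIn G S x y → S z × Adj G y z → WalkIn G S x z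
    here sx ▷ (sz , xz) = step sx xz (here sz)
    step sx xy walk ▷ next = step sx xy (walk ▷ next)

    _++ʷ_ : ∀ {x y z} → WalkIn G S x y → WalkIn G S y z → WalkIn G S x z
    here _ ++ʷ walk′ = walk′
    step sx xy walk ++ʷ walk′ = step sx xy (walk ++ʷ walk′)

    reverseʷ : ∀ {x y} → WalkIn G S x y → WalkIn G S y x
    reverseʷ (here sx) = here sx
    reverseʷ (step sx xy walk) = reverseʷ walk ▷ (sx , Adj-sym xy)

    walk-crosses : ∀ {P : Fin (n G) → Set} → Decidable P → ∀ {x z} → WalkIn G S x z →
                   P x → ¬ P z → ∃ λ y → P y × ∃ λ y′ → ¬ P y′ × Adj G y y′
    walk-crosses P? (here _) px ¬pz = ⊥-elim (¬pz px)
    walk-crosses P? (step {x} {y} _ xy walk) px ¬pz with P? y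
    ... | yes py = walk-crosses P? walk py ¬pz
    ... | no ¬py = x , px , y , ¬py , xy

  position : Ordering G → Fin (n G) → ℕ
  position σ x = toℕ (σ ⟨$⟩ˡ x)

  position-injective : ∀ σ {x y} → position σ x ≡ position σ y → x ≡ y
  position-injective σ {x} {y} eq = begin
    x                     ≡⟨ ≡.sym (inverseʳ σ) ⟩
    σ ⟨$⟩ʳ (σ ⟨$⟩ˡ x) ≡⟨ cong (σ ⟨$⟩ʳ_) (toℕ-injective eq) ⟩
    σ ⟨$⟩ʳ (σ ⟨$⟩ˡ y) ≡⟨ inverseʳ σ ⟩
    y                     ∎
    where open ≡.≡-Reasoning

  EarlierNeighbours : Ordering G → Set
  EarlierNeighbours σ = ∀ x → position σ x ≡ 0 ⊎ ∃ λ y → Before G σ y x × Adj G x y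

  walkToFirst : ∀ σ → EarlierNeighbours σ → ∀ k bound x → position σ x < bound → position σ x < k →
                ∃ λ r → position σ r ≡ 0 × WalkIn G (λ v → position σ v < k) x r
  walkToFirst σ earlier k (suc bound) x x<bound x<k with earlier x
  ... | inj₁ x-first = x , x-first , here x<k
  ... | inj₂ (y , y<x , xy)
    with walkToFirst σ earlier k bound y (<-≤-trans y<x (≤-pred x<bound)) (<-trans y<x x<k)
  ...   | r , r-first , y⇝r = r , r-first , step x<k xy y⇝r

  earlierNeighbours⇒IsGraphSearch : ∀ σ → EarlierNeighbours σ → IsGraphSearch G σ
  earlierNeighbours⇒IsGraphSearch σ earlier k x y x<k y<k
    with walkToFirst σ earlier k _ x ≤-refl x<k | walkToFirst σ earlier k _ y ≤-refl y<k
  ... | r , r-first , x⇝r | r′ , r′-first , y⇝r′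
    rewrite position-injective σ {r} {r′} (trans r-first (≡.sym r′-first)) =
    x⇝r ++ʷ reverseʷ y⇝r′

module GreedySearch (G : Graph) (bfsFrom : ℕ) where

  open Properties G

  private
    V : Set
    V = Fin (n G)

  _[_≔_] : (V → ℕ) → V → ℕ → V → ℕ
  (rank [ c ≔ i ]) x with x ≟ᶠ c
  ... | yes _ = i
  ... | no _ = rank x

  ≔-updates : ∀ rank c i → (rank [ c ≔ i ]) c ≡ i
  ≔-updates rank c i with c ≟ᶠ c
  ... | yes _ = refl
  ... | no c≢c = ⊥-elim (c≢c refl)

  ≔-keeps : ∀ rank {c} i {x} → x ≢ c → (rank [ c ≔ i ]) x ≡ rank x
  ≔-keeps rank {c} i {x} x≢c with x ≟ᶠ c
  ... | yes x≡c = ⊥-elim (x≢c x≡c)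
  ... | no _ = refl

  -- The first k vertices of a search under construction, ranked 0, …, k - 1; every
  -- other vertex carries the out-of-range rank n G.
  record PartialSearch (k : ℕ) : Set where
    field
      rank : V → ℕ
      visited-or-unseen : ∀ x → rank x < k ⊎ rank x ≡ n G
      rank-injective : ∀ x y → rank x < k → rank x ≡ rank y → x ≡ y
      rank-onto : ∀ i → i < k → ∃ λ x → rank x ≡ i
      earlier-neighbour : ∀ x → rank x < k → rank x ≡ 0 ⊎ ∃ λ y → rank y < rank x × Adj G x y
      bfs : ∀ a b c → bfsFrom ≤ rank b → rank a < rank b → rank b < k → rank b < rank c →
            Adj G a c → ¬ Adj G a b → ∃ λ d → rank d < rank a × Adj G d b

    vertexAt : Fin k → V
    vertexAt i = proj₁ (rank-onto (toℕ i) (toℕ<n i))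

    rank-vertexAt : ∀ i → rank (vertexAt i) ≡ toℕ i
    rank-vertexAt i = proj₂ (rank-onto (toℕ i) (toℕ<n i))

    vertexAt-injective : Injective _≡_ _≡_ vertexAt
    vertexAt-injective {i} {j} eq =
      toℕ-injective (trans (≡.sym (rank-vertexAt i)) (trans (cong rank eq) (rank-vertexAt j)))

    visited≤size : k ≤ n G
    visited≤size = injective⇒≤ vertexAt-injective

    unseen : ∀ {x} → k ≤ rank x → rank x ≡ n G
    unseen {x} k≤x with visited-or-unseen x
    ... | inj₁ x<k = ⊥-elim (<-irrefl refl (<-≤-trans x<k k≤x))
    ... | inj₂ x-unseen = x-unseen

    unseen⇒room : ∀ c → rank c ≡ n G → suc k ≤ n G
    unseen⇒room c c-unseen = injective⇒≤ {f = c∷vertexAt} c∷vertexAt-injective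
      where
      c∷vertexAt : Fin (suc k) → V
      c∷vertexAt zero = c
      c∷vertexAt (suc i) = vertexAt i
      c≢vertexAt : ∀ i → c ≢ vertexAt i
      c≢vertexAt i eq = <-irrefl (trans (≡.sym (rank-vertexAt i)) (trans (cong rank (≡.sym eq)) c-unseen))
                                 (<-≤-trans (toℕ<n i) visited≤size)
      c∷vertexAt-injective : Injective _≡_ _≡_ c∷vertexAt
      c∷vertexAt-injective {zero} {zero} _ = refl
      c∷vertexAt-injective {zero} {suc j} eq = ⊥-elim (c≢vertexAt j eq)
      c∷vertexAt-injective {suc i} {zero} eq = ⊥-elim (c≢vertexAt i (≡.sym eq))
      c∷vertexAt-injective {suc i} {suc j} eq = cong suc (vertexAt-injective eq)

  open PartialSearch public

  _⊑_ : ∀ {k k′} → PartialSearch k → PartialSearch k′ → Set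
  _⊑_ {k} st st′ = ∀ x → rank st x < k → rank st′ x ≡ rank st x

  ⊑-refl : ∀ {k} {st : PartialSearch k} → st ⊑ st
  ⊑-refl _ _ = refl

  ⊑-trans : ∀ {k k′ k″} {st : PartialSearch k} {st′ : PartialSearch k′} {st″ : PartialSearch k″} →
            st ⊑ st′ → st′ ⊑ st″ → st ⊑ st″
  ⊑-trans {st = st} {st′} st⊑st′ st′⊑st″ x x<k with visited-or-unseen st′ x
  ... | inj₁ x<k′ = trans (st′⊑st″ x x<k′) (st⊑st′ x x<k)
  ... | inj₂ x-unseen = ⊥-elim (<-irrefl (trans (≡.sym (st⊑st′ x x<k)) x-unseen)
                                          (<-≤-trans x<k (visited≤size st)))

  empty : PartialSearch 0
  empty = record
    { rank = λ _ → n G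
    ; visited-or-unseen = λ _ → inj₂ refl
    ; rank-injective = λ _ _ ()
    ; rank-onto = λ _ ()
    ; earlier-neighbour = λ _ ()
    ; bfs = λ _ _ _ _ _ ()
    }

  module Push {k} (st : PartialSearch k) (c : V) (c-unseen : rank st c ≡ n G)
    (c-linked : k ≡ 0 ⊎ ∃ λ y → rank st y < k × Adj G c y)
    (c-bfs : bfsFrom ≤ k → ∀ a e → rank st a < k → k ≤ rank st e → Adj G a e → ¬ Adj G a c →
             ∃ λ d → rank st d < rank st a × Adj G d c) where

    private
      r : V → ℕ
      r = rank st

    r′ : V → ℕ
    r′ = r [ c ≔ k ]

    k<size : k < n G
    k<size = unseen⇒room st c c-unseen

    c-or-other : ∀ x → x ≡ c ⊎ x ≢ c
    c-or-other x with x ≟ᶠ c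
    ... | yes x≡c = inj₁ x≡c
    ... | no x≢c = inj₂ x≢c

    c-new : r′ c ≡ k
    c-new = ≔-updates r c k

    keeps : ∀ {x} → x ≢ c → r′ x ≡ r x
    keeps = ≔-keeps r k

    visited≢c : ∀ {x} → r x < k → x ≢ c
    visited≢c x<k refl = <-irrefl c-unseen (<-trans x<k k<size)

    keeps-visited : ∀ {x} → r x < k → r′ x ≡ r x
    keeps-visited x<k = keeps (visited≢c x<k)

    no-rank-k : ∀ x → r x ≢ k
    no-rank-k x x≡k with visited-or-unseen st x
    ... | inj₁ x<k = <-irrefl x≡k x<k
    ... | inj₂ x-unseen = <-irrefl (trans (≡.sym x≡k) x-unseen) k<size

    old-visited : ∀ {x} → x ≢ c → r′ x < suc k → r x < k
    old-visited {x} x≢c x<1+k with visited-or-unseen st x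
    ... | inj₁ x<k = x<k
    ... | inj₂ x-unseen =
      ⊥-elim (<-irrefl x-unseen (≤-<-trans (m<1+n⇒m≤n (subst (_< suc k) (keeps x≢c) x<1+k)) k<size))

    below⇒≢c : ∀ {x} y → r′ x < r′ y → r′ y < suc k → x ≢ c
    below⇒≢c y x<y y<1+k refl = <-irrefl refl (<-≤-trans (subst (_< r′ y) c-new x<y) (m<1+n⇒m≤n y<1+k))

    visited-or-unseen′ : ∀ x → r′ x < suc k ⊎ r′ x ≡ n G
    visited-or-unseen′ x with c-or-other x
    ... | inj₁ refl = inj₁ (subst (_< suc k) (≡.sym c-new) ≤-refl)
    ... | inj₂ x≢c with visited-or-unseen st x
    ...   | inj₁ x<k = inj₁ (subst (_< suc k) (≡.sym (keeps x≢c)) (m<n⇒m<1+n x<k))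
    ...   | inj₂ x-unseen = inj₂ (trans (keeps x≢c) x-unseen)

    rank-injective′ : ∀ x y → r′ x < suc k → r′ x ≡ r′ y → x ≡ y
    rank-injective′ x y x<1+k eq with c-or-other x | c-or-other y
    ... | inj₁ refl | inj₁ refl = refl
    ... | inj₁ refl | inj₂ y≢c = ⊥-elim (no-rank-k y (trans (≡.sym (keeps y≢c)) (trans (≡.sym eq) c-new)))
    ... | inj₂ x≢c | inj₁ refl = ⊥-elim (no-rank-k x (trans (≡.sym (keeps x≢c)) (trans eq c-new)))
    ... | inj₂ x≢c | inj₂ y≢c =
      rank-injective st x y (old-visited x≢c x<1+k) (trans (≡.sym (keeps x≢c)) (trans eq (keeps y≢c)))

    rank-onto′ : ∀ i → i < suc k → ∃ λ x → r′ x ≡ i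
    rank-onto′ i i<1+k with i <? k
    ... | yes i<k with rank-onto st i i<k
    ...   | x , x≡i = x , trans (keeps-visited (subst (_< k) (≡.sym x≡i) i<k)) x≡i
    rank-onto′ i i<1+k | no i≮k = c , trans c-new (≤-antisym (≮⇒≥ i≮k) (m<1+n⇒m≤n i<1+k))

    earlier-neighbour′ : ∀ x → r′ x < suc k → r′ x ≡ 0 ⊎ ∃ λ y → r′ y < r′ x × Adj G x y
    earlier-neighbour′ x x<1+k with c-or-other x
    earlier-neighbour′ x x<1+k | inj₁ refl = linked c-linked
      where
      linked : k ≡ 0 ⊎ ∃ (λ y → r y < k × Adj G c y) → r′ c ≡ 0 ⊎ ∃ λ y → r′ y < r′ c × Adj G c y
      linked (inj₁ k≡0) = inj₁ (trans c-new k≡0)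
      linked (inj₂ (y , y<k , cy)) =
        inj₂ (y , subst₂ _<_ (≡.sym (keeps-visited y<k)) (≡.sym c-new) y<k , cy)
    earlier-neighbour′ x x<1+k | inj₂ x≢c with earlier-neighbour st x (old-visited x≢c x<1+k)
    ... | inj₁ x≡0 = inj₁ (trans (keeps x≢c) x≡0)
    ... | inj₂ (y , y<x , xy) =
      inj₂ (y , subst₂ _<_ (≡.sym (keeps-visited (<-trans y<x (old-visited x≢c x<1+k))))
                           (≡.sym (keeps x≢c)) y<x , xy)

    bfs-new : ∀ a e → bfsFrom ≤ r′ c → r′ a < r′ c → r′ c < r′ e →
              Adj G a e → ¬ Adj G a c → ∃ λ d → r′ d < r′ a × Adj G d c
    bfs-new a e from≤c a<c c<e ae ¬ac =
      lift (c-bfs (subst (bfsFrom ≤_) c-new from≤c) a e a<k k≤e ae ¬ac)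
      where
      a≢c : a ≢ c
      a≢c refl = <-irrefl refl a<c
      e≢c : e ≢ c
      e≢c refl = <-irrefl refl c<e
      a<k : r a < k
      a<k = subst₂ _<_ (keeps a≢c) c-new a<c
      k≤e : k ≤ r e
      k≤e = subst₂ _≤_ c-new (keeps e≢c) (<⇒≤ c<e)
      lift : (∃ λ d → r d < r a × Adj G d c) → ∃ λ d → r′ d < r′ a × Adj G d c
      lift (d , d<a , dc) =
        d , subst₂ _<_ (≡.sym (keeps-visited (<-trans d<a a<k))) (≡.sym (keeps a≢c)) d<a , dc

    bfs-old : ∀ a b e → b ≢ c → bfsFrom ≤ r′ b → r′ a < r′ b → r′ b < suc k → r′ b < r′ e →
              Adj G a e → ¬ Adj G a b → ∃ λ d → r′ d < r′ a × Adj G d b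
    bfs-old a b e b≢c from≤b a<b b<1+k b<e ae ¬ab =
      lift (bfs st a b e (subst (bfsFrom ≤_) (keeps b≢c) from≤b) a<b′ b<k b<e′ ae ¬ab)
      where
      a≢c : a ≢ c
      a≢c = below⇒≢c b a<b b<1+k
      b<k : r b < k
      b<k = old-visited b≢c b<1+k
      a<b′ : r a < r b
      a<b′ = subst₂ _<_ (keeps a≢c) (keeps b≢c) a<b
      b<e′ : r b < r e
      b<e′ with c-or-other e
      ... | inj₁ refl = subst (r b <_) (≡.sym c-unseen) (<-trans b<k k<size)
      ... | inj₂ e≢c = subst₂ _<_ (keeps b≢c) (keeps e≢c) b<e
      lift : (∃ λ d → r d < r a × Adj G d b) → ∃ λ d → r′ d < r′ a × Adj G d b
      lift (d , d<a , db) =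
        d , subst₂ _<_ (≡.sym (keeps-visited (<-trans d<a (<-trans a<b′ b<k)))) (≡.sym (keeps a≢c)) d<a , db

    bfs′ : ∀ a b e → bfsFrom ≤ r′ b → r′ a < r′ b → r′ b < suc k → r′ b < r′ e →
           Adj G a e → ¬ Adj G a b → ∃ λ d → r′ d < r′ a × Adj G d b
    bfs′ a b e from≤b a<b b<1+k b<e ae ¬ab with c-or-other b
    ... | inj₁ refl = bfs-new a e from≤b a<b b<e ae ¬ab
    ... | inj₂ b≢c = bfs-old a b e b≢c from≤b a<b b<1+k b<e ae ¬ab

    extended : PartialSearch (suc k)
    extended = record
      { rank = r′
      ; visited-or-unseen = visited-or-unseen′
      ; rank-injective = rank-injective′
      ; rank-onto = rank-onto′
      ; earlier-neighbour = earlier-neighbour′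
      ; bfs = bfs′
      }

  push : ∀ {k} (st : PartialSearch k) c → rank st c ≡ n G →
         (k ≡ 0 ⊎ ∃ λ y → rank st y < k × Adj G c y) →
         (bfsFrom ≤ k → ∀ a e → rank st a < k → k ≤ rank st e → Adj G a e → ¬ Adj G a c →
          ∃ λ d → rank st d < rank st a × Adj G d c) →
         PartialSearch (suc k)
  push = Push.extended

  push-extends : ∀ {k} (st : PartialSearch k) c c-unseen c-linked c-bfs →
                 st ⊑ push st c c-unseen c-linked c-bfs
  push-extends st c c-unseen c-linked c-bfs _ = Push.keeps-visited st c c-unseen c-linked c-bfs

  module _ (connected : Connected G) where

    bfsStep : ∀ {k} (st : PartialSearch k) → 0 < k → ∀ c₀ → k ≤ rank st c₀ →
              Σ (PartialSearch (suc k)) (st ⊑_)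
    bfsStep {k} st 0<k c₀ k≤c₀ = visit (minimiser frontier? (rank st) frontier-nonempty)
      where
      Frontier : V → Set
      Frontier a = rank st a < k × ∃ λ e → k ≤ rank st e × Adj G a e

      frontier? : Decidable Frontier
      frontier? a = (rank st a <? k) ×-dec any? (λ e → (k ≤? rank st e) ×-dec Adj? a e)

      frontier-nonempty : ∃ Frontier
      frontier-nonempty with root , root≡0 ← rank-onto st 0 0<k
        with a , a<k , e , e≮k , ae ←
          walk-crosses (λ x → rank st x <? k) (connected root c₀ tt tt)
                       (subst (_< k) (≡.sym root≡0) 0<k) (λ c₀<k → <-irrefl refl (<-≤-trans c₀<k k≤c₀))
        = a , a<k , e , ≮⇒≥ e≮k , ae

      visit : (∃ λ a₀ → Frontier a₀ × (∀ a → Frontier a → rank st a₀ ≤ rank st a)) →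
              Σ (PartialSearch (suc k)) (st ⊑_)
      visit (a₀ , (a₀<k , c , k≤c , a₀c) , a₀-earliest) =
        push st c c-unseen c-linked a₀-first , push-extends st c c-unseen c-linked a₀-first
        where
        c-unseen : rank st c ≡ n G
        c-unseen = unseen st k≤c
        c-linked : k ≡ 0 ⊎ ∃ λ y → rank st y < k × Adj G c y
        c-linked = inj₂ (a₀ , a₀<k , Adj-sym a₀c)
        a₀-first : bfsFrom ≤ k → ∀ a e → rank st a < k → k ≤ rank st e → Adj G a e → ¬ Adj G a c →
                   ∃ λ d → rank st d < rank st a × Adj G d c
        a₀-first _ a e a<k k≤e ae ¬ac =
          a₀ , ≤∧≢⇒< (a₀-earliest a (a<k , e , k≤e , ae))
                     (λ a₀≡a → ¬ac (subst (λ x → Adj G x c) (rank-injective st a₀ a a₀<k a₀≡a) a₀c))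
             , a₀c

    complete : ∀ fuel {k} (st : PartialSearch k) → 0 < k → n G ≤ fuel + k →
               ∃ λ K → Σ (PartialSearch K) λ st′ → st ⊑ st′ × (∀ x → rank st′ x < K)
    complete fuel {k} st 0<k size≤ with any? (λ x → k ≤? rank st x)
    ... | no all-visited = k , st , ⊑-refl {st = st} , λ x → ≰⇒> (λ k≤x → all-visited (x , k≤x))
    complete zero {k} st 0<k size≤ | yes (c , k≤c) =
      ⊥-elim (<-irrefl refl (≤-trans (unseen⇒room st c (unseen st k≤c)) size≤))
    complete (suc fuel) {k} st 0<k size≤ | yes (c , k≤c)
      with st′ , st⊑st′ ← bfsStep st 0<k c k≤c
      with K , st″ , st′⊑st″ , all-visited ←
             complete fuel st′ (s≤s z≤n) (subst (n G ≤_) (≡.sym (+-suc fuel k)) size≤)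
      = K , st″ , ⊑-trans {st = st} {st′} {st″} st⊑st′ st′⊑st″ , all-visited

≢0,1,2⇒3≤ : ∀ m → m ≢ 0 → m ≢ 1 → m ≢ 2 → 3 ≤ m
≢0,1,2⇒3≤ 0 m≢0 _ _ = ⊥-elim (m≢0 refl)
≢0,1,2⇒3≤ 1 _ m≢1 _ = ⊥-elim (m≢1 refl)
≢0,1,2⇒3≤ 2 _ _ m≢2 = ⊥-elim (m≢2 refl)
≢0,1,2⇒3≤ (suc (suc (suc m))) _ _ _ = s≤s (s≤s (s≤s z≤n))

module _ (G : Graph) where
  open Properties G

  record PrefixedSearch (x₀ x₁ x₂ : Fin (n G)) : Set where
    field
      σ : Ordering G
      x₀-first : position σ x₀ ≡ 0
      x₁-second : position σ x₁ ≡ 1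
      x₂-third : position σ x₂ ≡ 2
      earlier-neighbours : EarlierNeighbours σ
      bfs-after-prefix : ∀ a b c → 3 ≤ position σ b → Before G σ a b → Before G σ b c →
                         Adj G a c → ¬ Adj G a b → ∃ λ d → Before G σ d a × Adj G d b

    isGraphSearch : IsGraphSearch G σ
    isGraphSearch = earlierNeighbours⇒IsGraphSearch σ earlier-neighbours

    after-prefix : ∀ w → w ≢ x₀ → w ≢ x₁ → w ≢ x₂ → 3 ≤ position σ w
    after-prefix w w≢x₀ w≢x₁ w≢x₂ = ≢0,1,2⇒3≤ (position σ w)
      (λ w≡0 → w≢x₀ (position-injective σ (trans w≡0 (≡.sym x₀-first))))
      (λ w≡1 → w≢x₁ (position-injective σ (trans w≡1 (≡.sym x₁-second))))
      (λ w≡2 → w≢x₂ (position-injective σ (trans w≡2 (≡.sym x₂-third))))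

    isBFS : Adj G x₀ x₁ → Adj G x₀ x₂ → IsBFS G σ
    isBFS x₀x₁ x₀x₂ a b c a<b b<c ac ¬ab with 3 ≤? position σ b
    ... | yes 3≤b = bfs-after-prefix a b c 3≤b a<b b<c ac ¬ab
    ... | no 3≰b = inPrefix (position σ a) (position σ b) refl refl a<b 3≰b
      where
      same : ∀ {x y i} → position σ x ≡ i → position σ y ≡ i → x ≡ y
      same x≡i y≡i = position-injective σ (trans x≡i (≡.sym y≡i))
      inPrefix : ∀ i j → position σ a ≡ i → position σ b ≡ j → i < j → ¬ 3 ≤ j →
                 ∃ λ d → Before G σ d a × Adj G d b
      inPrefix 0 1 a≡0 b≡1 _ _ = ⊥-elim (¬ab (subst₂ (Adj G) (same x₀-first a≡0) (same x₁-second b≡1) x₀x₁))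
      inPrefix (suc _) 1 _ _ (s≤s ()) _
      inPrefix 0 2 a≡0 b≡2 _ _ = ⊥-elim (¬ab (subst₂ (Adj G) (same x₀-first a≡0) (same x₂-third b≡2) x₀x₂))
      inPrefix 1 2 a≡1 b≡2 _ _ =
        x₀ , subst₂ _<_ (≡.sym x₀-first) (≡.sym a≡1) (s≤s z≤n) , subst (Adj G x₀) (same x₂-third b≡2) x₀x₂
      inPrefix (suc (suc _)) 2 _ _ (s≤s (s≤s ())) _
      inPrefix _ (suc (suc (suc _))) _ _ _ 3≰j = ⊥-elim (3≰j (s≤s (s≤s (s≤s z≤n))))

  -- Opaque so that type checking never unfolds the construction of σ.
  opaque
    prefixedSearch : Connected G → ∀ {x₀ x₁ x₂} → x₀ ≢ x₁ → x₀ ≢ x₂ → x₁ ≢ x₂ →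
                     Adj G x₀ x₁ → Adj G x₀ x₂ ⊎ Adj G x₁ x₂ → PrefixedSearch x₀ x₁ x₂
    prefixedSearch connected {x₀} {x₁} {x₂} x₀≢x₁ x₀≢x₂ x₁≢x₂ x₀x₁ x₂-linked = record
      { σ = σ
      ; x₀-first = prefix-position x₀ ρ₃x₀≡0 (s≤s z≤n)
      ; x₁-second = prefix-position x₁ ρ₃x₁≡1 (s≤s (s≤s z≤n))
      ; x₂-third = prefix-position x₂ ρ₃x₂≡2 ≤-refl
      ; earlier-neighbours = earlier-neighbours
      ; bfs-after-prefix = bfs-after-prefix
      }
      where
      open GreedySearch G 3

      st₁ : PartialSearch 1
      st₁ = push empty x₀ refl (inj₁ refl) (λ ())
      ρ₁x₀≡0 : rank st₁ x₀ ≡ 0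
      ρ₁x₀≡0 = ≔-updates _ x₀ 0

      st₂ : PartialSearch 2
      st₂ = push st₁ x₁ (≔-keeps _ 0 (λ x₁≡x₀ → x₀≢x₁ (≡.sym x₁≡x₀)))
                 (inj₂ (x₀ , subst (_< 1) (≡.sym ρ₁x₀≡0) ≤-refl , Adj-sym x₀x₁)) (λ { (s≤s ()) })
      ρ₂x₀≡0 : rank st₂ x₀ ≡ 0
      ρ₂x₀≡0 = trans (≔-keeps (rank st₁) 1 x₀≢x₁) ρ₁x₀≡0
      ρ₂x₁≡1 : rank st₂ x₁ ≡ 1
      ρ₂x₁≡1 = ≔-updates _ x₁ 1

      st₃ : PartialSearch 3
      st₃ = push st₂ x₂ (trans (≔-keeps (rank st₁) 1 (λ x₂≡x₁ → x₁≢x₂ (≡.sym x₂≡x₁)))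
                               (≔-keeps _ 0 (λ x₂≡x₀ → x₀≢x₂ (≡.sym x₂≡x₀))))
                 (inj₂ (x₂-linked′ x₂-linked)) (λ { (s≤s (s≤s ())) })
        where
        x₂-linked′ : Adj G x₀ x₂ ⊎ Adj G x₁ x₂ → ∃ λ y → rank st₂ y < 2 × Adj G x₂ y
        x₂-linked′ (inj₁ x₀x₂) = x₀ , subst (_< 2) (≡.sym ρ₂x₀≡0) (s≤s z≤n) , Adj-sym x₀x₂
        x₂-linked′ (inj₂ x₁x₂) = x₁ , subst (_< 2) (≡.sym ρ₂x₁≡1) ≤-refl , Adj-sym x₁x₂
      ρ₃x₀≡0 : rank st₃ x₀ ≡ 0
      ρ₃x₀≡0 = trans (≔-keeps (rank st₂) 2 x₀≢x₂) ρ₂x₀≡0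
      ρ₃x₁≡1 : rank st₃ x₁ ≡ 1
      ρ₃x₁≡1 = trans (≔-keeps (rank st₂) 2 x₁≢x₂) ρ₂x₁≡1
      ρ₃x₂≡2 : rank st₃ x₂ ≡ 2
      ρ₃x₂≡2 = ≔-updates _ x₂ 2

      completion : ∃ λ K → Σ (PartialSearch K) λ st → st₃ ⊑ st × (∀ x → rank st x < K)
      completion = complete connected (n G) st₃ (s≤s z≤n) (m≤m+n (n G) 3)
      st : PartialSearch (proj₁ completion)
      st = proj₁ (proj₂ completion)
      st₃⊑st : st₃ ⊑ st
      st₃⊑st = proj₁ (proj₂ (proj₂ completion))
      all-visited : ∀ x → rank st x < proj₁ completion
      all-visited = proj₂ (proj₂ (proj₂ completion))

      ordering : Σ (Ordering G) λ σ → ∀ x → position σ x ≡ rank st x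
      ordering = rankPermutation (rank st) (λ x → <-≤-trans (all-visited x) (visited≤size st))
                                 (λ x y → rank-injective st x y (all-visited x))
      σ : Ordering G
      σ = proj₁ ordering
      position≡rank : ∀ x → position σ x ≡ rank st x
      position≡rank = proj₂ ordering

      rank<⇒before : ∀ {x y} → rank st x < rank st y → Before G σ x y
      rank<⇒before {x} {y} = subst₂ _<_ (≡.sym (position≡rank x)) (≡.sym (position≡rank y))

      before⇒rank< : ∀ {x y} → Before G σ x y → rank st x < rank st y
      before⇒rank< {x} {y} = subst₂ _<_ (position≡rank x) (position≡rank y)

      prefix-position : ∀ x {i} → rank st₃ x ≡ i → i < 3 → position σ x ≡ i
      prefix-position x x≡i i<3 =
        trans (position≡rank x) (trans (st₃⊑st x (subst (_< 3) (≡.sym x≡i) i<3)) x≡i)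

      earlier-neighbours : EarlierNeighbours σ
      earlier-neighbours x with earlier-neighbour st x (all-visited x)
      ... | inj₁ x≡0 = inj₁ (trans (position≡rank x) x≡0)
      ... | inj₂ (y , y<x , xy) = inj₂ (y , rank<⇒before y<x , xy)

      bfs-after-prefix : ∀ a b c → 3 ≤ position σ b → Before G σ a b → Before G σ b c →
                         Adj G a c → ¬ Adj G a b → ∃ λ d → Before G σ d a × Adj G d b
      bfs-after-prefix a b c 3≤b a<b b<c ac ¬ab
        with d , d<a , db ← bfs st a b c (subst (3 ≤_) (position≡rank b) 3≤b) (before⇒rank< a<b)
                                     (all-visited b) (before⇒rank< b<c) ac ¬ab
        = d , rank<⇒before d<a , db

  record TailedCherry : Set where
    field
      r u v w : Fin (n G)
      ru : Adj G r u
      rv : Adj G r v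
      ¬uv : ¬ Adj G u v
      uw : Adj G u w
      u≢v : u ≢ v
      w≢r : w ≢ r
      w≢v : w ≢ v

  module _ (connected : Connected G) (cherry : TailedCherry) where
    open TailedCherry cherry

    private
      w≢u : w ≢ u
      w≢u w≡u = Adj⇒≢ uw (≡.sym w≡u)

    tailedCherry⇒¬BFS : ∃ λ σ → IsGraphSearch G σ × ¬ IsBFS G σ
    tailedCherry⇒¬BFS = σ , isGraphSearch , ¬bfs
      where
      open PrefixedSearch
        (prefixedSearch connected (Adj⇒≢ (Adj-sym ru)) u≢v (Adj⇒≢ rv) (Adj-sym ru) (inj₂ rv))
      ¬bfs : ¬ IsBFS G σ
      ¬bfs bfs
        with d , d<u , _ ← bfs u v w (subst₂ _<_ (≡.sym x₀-first) (≡.sym x₂-third) (s≤s z≤n))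
                                 (subst (_< position σ w) (≡.sym x₂-third) (after-prefix w w≢u w≢r w≢v))
                                 uw ¬uv
        = n≮0 (subst (position σ d <_) x₀-first d<u)

    tailedCherry⇒BFS∧¬DFS : ∃ λ σ → IsGraphSearch G σ × IsBFS G σ × ¬ IsDFS G σ
    tailedCherry⇒BFS∧¬DFS = σ , isGraphSearch , isBFS ru rv , ¬dfs
      where
      open PrefixedSearch (prefixedSearch connected (Adj⇒≢ ru) (Adj⇒≢ rv) u≢v ru (inj₁ rv))
      ¬dfs : ¬ IsDFS G σ
      ¬dfs dfs
        with d , u<d , d<v , _ ← dfs u v w (subst₂ _<_ (≡.sym x₁-second) (≡.sym x₂-third) ≤-refl)
                                       (subst (_< position σ w) (≡.sym x₂-third) (after-prefix w w≢r w≢u w≢v))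
                                       uw ¬uv
        = <-irrefl refl (<-≤-trans (subst (position σ d <_) x₂-third d<v)
                                   (subst (_< position σ d) x₁-second u<d))

inducedSub⇒tailedCherry : ∀ {H G} → InducedSub H G → TailedCherry H → TailedCherry G
inducedSub⇒tailedCherry (f , f-injective , adj-preserved) cherry = record
  { r = f r ; u = f u ; v = f v ; w = f w
  ; ru = trans (≡.sym (adj-preserved r u)) ru
  ; rv = trans (≡.sym (adj-preserved r v)) rv
  ; ¬uv = λ fufv → ¬uv (trans (adj-preserved u v) fufv)
  ; uw = trans (≡.sym (adj-preserved u w)) uw
  ; u≢v = λ fu≡fv → u≢v (f-injective fu≡fv)
  ; w≢r = λ fw≡fr → w≢r (f-injective fw≡fr)
  ; w≢v = λ fw≡fv → w≢v (f-injective fw≡fv)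
  }
  where open TailedCherry cherry

tailedCherry-P4 : TailedCherry P4
tailedCherry-P4 = record
  { r = f1 ; u = f2 ; v = f0 ; w = f3 ; ru = refl ; rv = refl ; ¬uv = λ () ; uw = refl
  ; u≢v = λ () ; w≢r = λ () ; w≢v = λ () }

tailedCherry-C4 : TailedCherry C4
tailedCherry-C4 = record
  { r = f0 ; u = f1 ; v = f3 ; w = f2 ; ru = refl ; rv = refl ; ¬uv = λ () ; uw = refl
  ; u≢v = λ () ; w≢r = λ () ; w≢v = λ () }

tailedCherry-Paw : TailedCherry Paw
tailedCherry-Paw = record
  { r = f0 ; u = f1 ; v = f3 ; w = f2 ; ru = refl ; rv = refl ; ¬uv = λ () ; uw = refl
  ; u≢v = λ () ; w≢r = λ () ; w≢v = λ () }

tailedCherry-Diamond : TailedCherry Diamond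
tailedCherry-Diamond = record
  { r = f0 ; u = f2 ; v = f3 ; w = f1 ; ru = refl ; rv = refl ; ¬uv = λ () ; uw = refl
  ; u≢v = λ () ; w≢r = λ () ; w≢v = λ () }

lemma1 : (G : Graph) → Connected G →
    ((∀ σ → IsGraphSearch G σ → IsBFS G σ)
    ⊎ (∀ σ → IsGraphSearch G σ → IsDFS G σ)
    ⊎ (∀ σ → IsBFS G σ ⇔ IsDFS G σ)) →
    P4C4PawDiamondFree G
lemma1 G connected searches =
    excludes tailedCherry-P4 , excludes tailedCherry-C4
  , excludes tailedCherry-Paw , excludes tailedCherry-Diamond
  where
  noTailedCherry : TailedCherry G → ⊥
  noTailedCherry cherry
    with σ , search , ¬bfs ← tailedCherry⇒¬BFS G connected cherry
       | σ′ , search′ , bfs′ , ¬dfs′ ← tailedCherry⇒BFS∧¬DFS G connected cherry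
    = [ (λ search⇒bfs → ¬bfs (search⇒bfs σ search))
      , [ (λ search⇒dfs → ¬dfs′ (search⇒dfs σ′ search′))
        , (λ bfs⇔dfs → ¬dfs′ (Equivalence.to (bfs⇔dfs σ′) bfs′)) ]′ ]′ searches
  excludes : ∀ {H} → TailedCherry H → ¬ InducedSub H G
  excludes cherry H⊆G = noTailedCherry (inducedSub⇒tailedCherry H⊆G cherry)
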